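{- Let $m\ge 3$ be an integer and let $G$ be a graph on $\lfloor (32m+2010)/3\rfloor$ vertices. Let $v_1$ be a vertex with $d_G(v_1)\ge (16m+1004)/3$, and suppose $V_1,V_2,V_3$ are pairwise disjoint vertex sets, each inducing a clique in $G$ with at least $\lceil (4m+998)/3\rceil$ vertices, with no edges of $G$ between any two of them, such that $V_1\cup V_2\cup V_3$ is obtained from $N(v_1)$ by deleting two vertices. If there exists a vertex $v_2 \in V_1 \cup V_2 \cup V_3$ with $d_G(v_2) \ge (16m+1004)/3$, then $G$ or its complement $\overline{G}$ contains $W_{2m+2}$ as a subgraph.
   Context: The wheel $W_k$ is the graph on $k$ vertices obtained by adding a new vertex adjacent to every vertex of the cycle $C_{k-1}$. $N(v)$ denotes the set of neighbors of $v$ in $G$, and $d_G(v)=|N(v)|$. -}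

module Defs where

open import Data.Nat using (ℕ; zero; suc; _≡ᵇ_; _%_)
open import Data.Bool using (Bool; true; false; _∧_; _∨_; not)
open import Data.Fin using (Fin; zero; suc; toℕ)
open import Data.Fin.Subset using (Subset; ∣_∣)
open import Data.Vec using (tabulate)
open import Data.Product using (Σ; _×_)
open import Relation.Binary.PropositionalEquality using (_≡_; refl)
open import Function.Definitions using (Injective)

record Graph (n : ℕ) : Set where
  field
    adj    : Fin n → Fin n → Bool
    sym    : ∀ x y → adj x y ≡ adj y x
    irrefl : ∀ x → adj x x ≡ false
open Graph public

_==_ : ∀ {n} → Fin n → Fin n → Bool
zero  == zero  = true
zero  == suc y = false
suc x == zero  = false
suc x == suc y = x == y

==-sym : ∀ {n} (x y : Fin n) → (x == y) ≡ (y == x)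
==-sym zero    zero    = refl
==-sym zero    (suc y) = refl
==-sym (suc x) zero    = refl
==-sym (suc x) (suc y) = ==-sym x y

==-refl : ∀ {n} (x : Fin n) → (x == x) ≡ true
==-refl zero    = refl
==-refl (suc x) = ==-refl x

complement : ∀ {n} → Graph n → Graph n
complement {n} G = record { adj = a ; sym = s ; irrefl = i }
  where
  a : Fin n → Fin n → Bool
  a x y = not (adj G x y) ∧ not (x == y)
  s : ∀ x y → a x y ≡ a y x
  s x y rewrite sym G x y | ==-sym x y = refl
  i : ∀ x → a x x ≡ false
  i x rewrite irrefl G x | ==-refl x = refl

N : ∀ {n} → Graph n → Fin n → Subset n
N G v = tabulate (λ w → adj G v w)

deg : ∀ {n} → Graph n → Fin n → ℕ
deg G v = ∣ N G v ∣

cycleAdj : (l : ℕ) → Fin (suc l) → Fin (suc l) → Bool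
cycleAdj l i j = (toℕ j ≡ᵇ (suc (toℕ i) % suc l)) ∨ (toℕ i ≡ᵇ (suc (toℕ j) % suc l))

-- Adjacency of the wheel W_{l+2} on Fin (suc (suc l)):
-- vertex zero is the hub, adjacent to every vertex of the cycle C_{l+1} on the remaining vertices.
wheelAdj : (l : ℕ) → Fin (suc (suc l)) → Fin (suc (suc l)) → Bool
wheelAdj l zero    zero    = false
wheelAdj l zero    (suc j) = true
wheelAdj l (suc i) zero    = true
wheelAdj l (suc i) (suc j) = cycleAdj l i j

ContainsSubgraph : ∀ {n k} → Graph n → (Fin k → Fin k → Bool) → Set
ContainsSubgraph {n} {k} G H =
  Σ (Fin k → Fin n) λ f → Injective _≡_ _≡_ f × (∀ x y → H x y ≡ true → adj G (f x) (f y) ≡ true)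

ContainsWheel : ∀ {n} → Graph n → ℕ → Set
ContainsWheel G l = ContainsSubgraph G (wheelAdj l)

-- Let Jᵢ be the set of vertices adjacent to every vertex of Vᵢ other than themselves, so Vᵢ ⊆ Jᵢ.
-- If |Jᵢ| ≥ 2m + 2 for some i, a hub in Vᵢ and a rim alternating between Vᵢ and Jᵢ form W_{2m+2} in G.
-- Otherwise |J₁ ∪ J₂ ∪ J₃| ≤ 6m + 3 is less than the order of G, so some vertex x has a non-neighbour yᵢ
-- in every Vᵢ. In the complement, where V₁, V₂, V₃ are mutually complete, y₂ is then the hub of the rim
-- y₁ x y₃ a₁ d₁ … a_{m-1} d_{m-1} with aⱼ ∈ V₁ and dⱼ ∈ V₃.
module Submission where

open import Defs
open import Data.Nat using (ℕ; _+_; _*_; _≤_; _/_)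
open import Data.Bool using (true; false)
open import Data.Fin using (Fin)
open import Data.Fin.Subset using (Subset; _∈_; ∣_∣)
open import Data.Product using (Σ; _×_)
open import Data.Sum using (_⊎_)
open import Relation.Binary.PropositionalEquality using (_≡_; _≢_)
open import Relation.Nullary using (¬_)

open import Level using (Level)
open import Function using (_∘_; _$_)
open import Function.Bundles using (Equivalence)
open import Function.Definitions using (Injective)
open import Data.Nat using (suc; _<_; z≤n; s≤s; s≤s⁻¹; _%_; _≤?_; _<?_)
open import Data.Nat.Properties
open import Data.Nat.DivMod using (m<n⇒m%n≡m; n%n≡0; m*n/n≡m; /-monoˡ-≤)
open import Data.Nat.Tactic.RingSolver using (solve-∀)
open import Data.Bool.Properties using (T-≡; T-∨; ¬-not) renaming (_≟_ to _≟ᵇ_)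
open import Data.Fin using (toℕ) renaming (zero to fzero; suc to fsuc)
open import Data.Fin.Properties using (toℕ<n; toℕ-injective; any?) renaming (suc-injective to fsuc-injective; _≟_ to _≟ᶠ_)
open import Data.Fin.Subset using (inside; outside; _∉_; _∪_; _─_; _-_; ∁; ⁅_⁆; _⊆_)
open import Data.Fin.Subset.Properties
  using (_∈?_; x∈p∪q⁺; p⊆q⇒∣p∣≤∣q∣; p─q⊆p; x∈p∧x∉q⇒x∈p─q; ∣⁅x⁆∣≡1; x∈⁅x⁆;
         x∈∁p⇒x∉p; x∉∁p⇒x∈p; x∉p⇒x∈∁p)
open import Data.Vec using ([]; _∷_; here; there; tabulate)
open import Data.Vec.Properties using ([]=⇒lookup; lookup⇒[]=; lookup∘tabulate)
open import Data.List using (List; []; _∷_; _++_; length; lookup; map; take; drop)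
open import Data.List.Properties using (length-map; length-take; length-++; take++drop≡id; ++-assoc)
open import Data.List.Relation.Unary.All as All using (All; []; _∷_)
import Data.List.Relation.Unary.All.Properties as All
open import Data.List.Relation.Unary.AllPairs using ([]; _∷_)
open import Data.List.Relation.Unary.Linked using (Linked; []; [-]; _∷_)
open import Data.List.Relation.Unary.Unique.Propositional using (Unique)
import Data.List.Relation.Unary.Unique.Propositional.Properties as Unique
open import Data.List.Membership.Propositional.Properties using (∈-lookup)
open import Data.List.Relation.Binary.Permutation.Propositional
  using (_↭_; ↭-refl; ↭-prep; ↭-trans; ↭-sym; ↭⇒↭ₛ)
open import Data.List.Relation.Binary.Permutation.Propositional.Properties using (++-comm; ↭-length; shift)
import Data.List.Relation.Binary.Permutation.Setoid.Properties as Permutationₛ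
open import Data.Product using (∃; _,_)
open import Data.Sum using (inj₁; inj₂; [_,_]′)
open import Relation.Nullary using (Dec; yes; no; ¬?; contradiction)
open import Relation.Nullary.Decidable using (_×-dec_; does)
open import Relation.Unary using (Pred; Decidable)
open import Relation.Binary.PropositionalEquality as ≡ using (refl; trans; cong; cong₂; subst; subst₂; setoid)

private
  variable
    a p q r : Level
    A : Set a
    n : ℕ

module _ {A : Set a} where

  interleave : List A → List A → List A
  interleave []       ys = ys
  interleave (x ∷ xs) ys = x ∷ interleave ys xs

  interleave-↭ : ∀ (xs ys : List A) → interleave xs ys ↭ xs ++ ys
  interleave-↭ []       ys = ↭-refl
  interleave-↭ (x ∷ xs) ys = ↭-prep x (↭-trans (interleave-↭ ys xs) (++-comm ys xs))

  length-interleave : ∀ (xs ys : List A) → length (interleave xs ys) ≡ length xs + length ys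
  length-interleave xs ys = trans (↭-length (interleave-↭ xs ys)) (length-++ xs)

  All-interleave : ∀ {P : Pred A p} {xs ys} → All P xs → All P ys → All P (interleave xs ys)
  All-interleave []         pys = pys
  All-interleave (px ∷ pxs) pys = px ∷ All-interleave pys pxs

  Linked-interleave : ∀ {P : Pred A p} {Q : Pred A q} {R : A → A → Set r} →
    (∀ {x y} → P x → Q y → R x y) → (∀ {y x} → Q y → P x → R y x) →
    ∀ {x xs ys} → P x → All P xs → All Q ys → length ys ≡ length xs →
    Linked R (x ∷ interleave ys xs)
  Linked-interleave PQ QP px []          []         _ = [-]
  Linked-interleave PQ QP px (px′ ∷ pxs) (qy ∷ qys) e =
    PQ px qy ∷ QP qy px′ ∷ Linked-interleave PQ QP px′ pxs qys (suc-injective e)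

  last⁺ : A → List A → A
  last⁺ x []       = x
  last⁺ _ (y ∷ ys) = last⁺ y ys

  last⁺-interleave : ∀ {P : Pred A p} {x xs ys} → P x → All P xs → length ys ≡ length xs →
                     P (last⁺ x (interleave ys xs))
  last⁺-interleave {ys = []}    px []          _ = px
  last⁺-interleave {ys = _ ∷ ys} px (px′ ∷ pxs) e = last⁺-interleave {ys = ys} px′ pxs (suc-injective e)

  lookup-last⁺ : ∀ x xs (i : Fin (length (x ∷ xs))) → toℕ i ≡ length xs → lookup (x ∷ xs) i ≡ last⁺ x xs
  lookup-last⁺ x []       fzero    _ = refl
  lookup-last⁺ x (y ∷ ys) (fsuc i) e = lookup-last⁺ y ys i (suc-injective e)

  lookup-Linked : ∀ {R : A → A → Set r} {xs} → Linked R xs →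
                  ∀ {i j : Fin (length xs)} → toℕ j ≡ suc (toℕ i) → R (lookup xs i) (lookup xs j)
  lookup-Linked (r ∷ _) {fzero}  {fsuc fzero} _ = r
  lookup-Linked (_ ∷ l) {fsuc i} {fsuc j}     e = lookup-Linked l (suc-injective e)

  lookup-injective : ∀ {xs : List A} → Unique xs → Injective _≡_ _≡_ (lookup xs)
  lookup-injective (_   ∷ _) {fzero}  {fzero}  _ = refl
  lookup-injective (x∉ ∷ _) {fzero}  {fsuc j} e = contradiction e (All.lookup x∉ (∈-lookup j))
  lookup-injective (x∉ ∷ _) {fsuc i} {fzero}  e = contradiction (≡.sym e) (All.lookup x∉ (∈-lookup i))
  lookup-injective (_   ∷ u) {fsuc i} {fsuc j} e = cong fsuc (lookup-injective u e)

  Unique-resp-↭ : ∀ {xs ys : List A} → xs ↭ ys → Unique xs → Unique ys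
  Unique-resp-↭ xs↭ys = Permutationₛ.Unique-resp-↭ (setoid A) (↭⇒↭ₛ xs↭ys)

  All-≢ : ∀ {P : Pred A p} {x xs} → ¬ P x → All P xs → All (x ≢_) xs
  All-≢ {P = P} ¬px = All.map λ py x≡y → ¬px (subst P (≡.sym x≡y) py)

  Unique-++-separated : ∀ {P : Pred A p} {Q : Pred A q} {xs ys} → (∀ {x} → P x → ¬ Q x) →
    All P xs → All Q ys → Unique xs → Unique ys → Unique (xs ++ ys)
  Unique-++-separated P⇒¬Q pxs qys uxs uys =
    Unique.++⁺ uxs uys λ (x∈xs , x∈ys) → P⇒¬Q (All.lookup pxs x∈xs) (All.lookup qys x∈ys)

  ++-take : ∀ (xs : List A) {ys} k → xs ++ take k ys ≡ take (length xs + k) (xs ++ ys)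
  ++-take []       k = refl
  ++-take (x ∷ xs) k = cong (x ∷_) (++-take xs k)

  length-interleave-≡ : ∀ (xs ys : List A) {k} → length xs ≡ k → length ys ≡ k →
                        length (interleave xs ys) ≡ 2 * k
  length-interleave-≡ xs ys {k} ∣xs∣≡k ∣ys∣≡k = begin
    length (interleave xs ys) ≡⟨ length-interleave xs ys ⟩
    length xs + length ys     ≡⟨ cong₂ _+_ ∣xs∣≡k ∣ys∣≡k ⟩
    k + k                     ≡⟨ cong (k +_) (+-identityʳ k) ⟨
    2 * k                     ∎
    where open ≡.≡-Reasoning

  length-take-≤ : ∀ k {xs : List A} → k ≤ length xs → length (take k xs) ≡ k
  length-take-≤ k {xs} k≤ = trans (length-take k xs) (m≤n⇒m⊓n≡m k≤)

elements : Subset n → List (Fin n)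
elements []            = []
elements (inside  ∷ p) = fzero ∷ map fsuc (elements p)
elements (outside ∷ p) = map fsuc (elements p)

elements-⊆ : ∀ (p : Subset n) → All (_∈ p) (elements p)
elements-⊆ []            = []
elements-⊆ (inside  ∷ p) = here ∷ All.map⁺ (All.map there (elements-⊆ p))
elements-⊆ (outside ∷ p) = All.map⁺ (All.map there (elements-⊆ p))

elements-unique : ∀ (p : Subset n) → Unique (elements p)
elements-unique []            = []
elements-unique (inside  ∷ p) =
  All.map⁺ (All.universal (λ _ ()) _) ∷ Unique.map⁺ fsuc-injective (elements-unique p)
elements-unique (outside ∷ p) = Unique.map⁺ fsuc-injective (elements-unique p)

length-elements : ∀ (p : Subset n) → length (elements p) ≡ ∣ p ∣
length-elements []            = refl
length-elements (inside  ∷ p) = cong suc (trans (length-map fsuc (elements p)) (length-elements p))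
length-elements (outside ∷ p) = trans (length-map fsuc (elements p)) (length-elements p)

∣p∪q∣≤∣p∣+∣q∣ : ∀ (p q : Subset n) → ∣ p ∪ q ∣ ≤ ∣ p ∣ + ∣ q ∣
∣p∪q∣≤∣p∣+∣q∣ []            []            = z≤n
∣p∪q∣≤∣p∣+∣q∣ (inside  ∷ p) (inside  ∷ q) = s≤s (≤-trans (∣p∪q∣≤∣p∣+∣q∣ p q) (+-monoʳ-≤ ∣ p ∣ (n≤1+n ∣ q ∣)))
∣p∪q∣≤∣p∣+∣q∣ (inside  ∷ p) (outside ∷ q) = s≤s (∣p∪q∣≤∣p∣+∣q∣ p q)
∣p∪q∣≤∣p∣+∣q∣ (outside ∷ p) (inside  ∷ q) = ≤-trans (s≤s (∣p∪q∣≤∣p∣+∣q∣ p q)) (≤-reflexive (≡.sym (+-suc ∣ p ∣ ∣ q ∣)))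
∣p∪q∣≤∣p∣+∣q∣ (outside ∷ p) (outside ∷ q) = ∣p∪q∣≤∣p∣+∣q∣ p q

∣p∣≤∣p─q∣+∣q∣ : ∀ (p q : Subset n) → ∣ p ∣ ≤ ∣ p ─ q ∣ + ∣ q ∣
∣p∣≤∣p─q∣+∣q∣ p q = ≤-trans (p⊆q⇒∣p∣≤∣q∣ p⊆p─q∪q) (∣p∪q∣≤∣p∣+∣q∣ (p ─ q) q)
  where
  p⊆p─q∪q : p ⊆ (p ─ q) ∪ q
  p⊆p─q∪q {x} x∈p with x ∈? q
  ... | yes x∈q = x∈p∪q⁺ (inj₂ x∈q)
  ... | no  x∉q = x∈p∪q⁺ (inj₁ (x∈p∧x∉q⇒x∈p─q x∈p x∉q))

∣p∣≤1+∣p-x∣ : ∀ (p : Subset n) x → ∣ p ∣ ≤ suc ∣ p - x ∣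
∣p∣≤1+∣p-x∣ p x = ≤-trans (∣p∣≤∣p─q∣+∣q∣ p ⁅ x ⁆) (≤-reflexive (trans (cong (∣ p - x ∣ +_) (∣⁅x⁆∣≡1 x)) (+-comm _ 1)))

x∈p─q⇒x∉q : ∀ {p q : Subset n} {x} → x ∈ p ─ q → x ∉ q
x∈p─q⇒x∉q {p = _ ∷ _} {outside ∷ _} here          ()
x∈p─q⇒x∉q {p = _ ∷ _} {_       ∷ _} (there x∈p─q) (there x∈q) = x∈p─q⇒x∉q x∈p─q x∈q

∣p∣<n⇒∃∉ : ∀ (p : Subset n) → ∣ p ∣ < n → ∃ (_∉ p)
∣p∣<n⇒∃∉ (outside ∷ p) _ = fzero , λ ()
∣p∣<n⇒∃∉ (inside  ∷ p) ∣p∣<n with ∣p∣<n⇒∃∉ p (s≤s⁻¹ ∣p∣<n)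
... | x , x∉p = fsuc x , λ { (there x∈p) → x∉p x∈p }

distinct-elements : ∀ (p : Subset n) k → k ≤ ∣ p ∣ →
  Σ (List (Fin n)) λ xs → length xs ≡ k × All (_∈ p) xs × Unique xs
distinct-elements p k k≤∣p∣ =
  take k (elements p) , length-take-≤ k (subst (k ≤_) (≡.sym (length-elements p)) k≤∣p∣)
  , All.take⁺ k (elements-⊆ p) , Unique.take⁺ k (elements-unique p)

x∉p-x : ∀ (p : Subset n) x → x ∉ p - x
x∉p-x p x x∈p-x = x∈p─q⇒x∉q x∈p-x (x∈⁅x⁆ x)

satisfying : {P : Pred (Fin n) p} → Decidable P → Subset n
satisfying P? = tabulate (does ∘ P?)

module _ {P : Pred (Fin n) p} (P? : Decidable P) where

  ∈-satisfying⁻ : ∀ {x} → x ∈ satisfying P? → P x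
  ∈-satisfying⁻ {x} x∈ with P? x | trans (≡.sym (lookup∘tabulate (does ∘ P?) x)) ([]=⇒lookup x∈)
  ... | yes px | _ = px
  ... | no  _  | ()

  ∈-satisfying⁺ : ∀ {x} → P x → x ∈ satisfying P?
  ∈-satisfying⁺ {x} px = lookup⇒[]= x _ (trans (lookup∘tabulate (does ∘ P?) x) (does-yes (P? x)))
    where
    does-yes : (d : Dec (P x)) → does d ≡ true
    does-yes (yes _)  = refl
    does-yes (no ¬px) = contradiction px ¬px

Adjacent : Graph n → Fin n → Fin n → Set
Adjacent G x y = adj G x y ≡ true

AdjacentIfDistinct : Graph n → Fin n → Fin n → Set
AdjacentIfDistinct G x y = x ≢ y → Adjacent G x y

CompleteTo : Graph n → Subset n → Subset n → Set
CompleteTo G X Y = ∀ x y → x ∈ X → y ∈ Y → AdjacentIfDistinct G x y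

Anticomplete : Graph n → Subset n → Subset n → Set
Anticomplete G X Y = ∀ x y → x ∈ X → y ∈ Y → adj G x y ≡ false

module _ (G : Graph n) where

  Adjacent-sym : ∀ {x y} → Adjacent G x y → Adjacent G y x
  Adjacent-sym {x} {y} xy = trans (sym G y x) xy

  Adjacent⇒≢ : ∀ {x y} → Adjacent G x y → x ≢ y
  Adjacent⇒≢ {x} xx refl = contradiction (trans (≡.sym xx) (irrefl G x)) λ ()

  AdjacentIfDistinct-sym : ∀ {x y} → AdjacentIfDistinct G x y → AdjacentIfDistinct G y x
  AdjacentIfDistinct-sym xy y≢x = Adjacent-sym (xy (y≢x ∘ ≡.sym))

  CompleteTo-sym : ∀ {X Y} → CompleteTo G X Y → CompleteTo G Y X
  CompleteTo-sym XY y x y∈Y x∈X = AdjacentIfDistinct-sym (XY x y x∈X y∈Y)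

==-≢ : ∀ {x y : Fin n} → x ≢ y → (x == y) ≡ false
==-≢ {x = fzero}  {fzero}  x≢y = contradiction refl x≢y
==-≢ {x = fzero}  {fsuc _} _   = refl
==-≢ {x = fsuc _} {fzero}  _   = refl
==-≢ {x = fsuc _} {fsuc _} x≢y = ==-≢ (x≢y ∘ cong fsuc)

nonadjacent⇒AdjacentIfDistinct-complement : ∀ (G : Graph n) {x y} → adj G x y ≡ false →
  AdjacentIfDistinct (complement G) x y
nonadjacent⇒AdjacentIfDistinct-complement G xy≡false x≢y rewrite xy≡false | ==-≢ x≢y = refl

Anticomplete⇒CompleteTo-complement : ∀ (G : Graph n) {X Y} → Anticomplete G X Y → CompleteTo (complement G) X Y
Anticomplete⇒CompleteTo-complement G XY x y x∈X y∈Y =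
  nonadjacent⇒AdjacentIfDistinct-complement G (XY x y x∈X y∈Y)

cyclic-successor : ∀ {k i j} → i < suc k → j ≡ suc i % suc k → (j ≡ suc i) ⊎ (i ≡ k × j ≡ 0)
cyclic-successor {k} {i} i<1+k j≡ with i <? k
... | yes i<k = inj₁ (trans j≡ (m<n⇒m%n≡m (s≤s i<k)))
... | no  i≮k = inj₂ (i≡k , trans j≡ (subst (λ l → suc l % suc k ≡ 0) (≡.sym i≡k) (n%n≡0 (suc k))))
  where
  i≡k : i ≡ k
  i≡k = ≤-antisym (s≤s⁻¹ i<1+k) (≮⇒≥ i≮k)

cyclic-successor-≢ : ∀ {k i j} → 1 ≤ k → i < suc k → j ≡ suc i % suc k → i ≢ j
cyclic-successor-≢ 1≤k i<1+k j≡ with cyclic-successor i<1+k j≡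
... | inj₁ j≡1+i          = λ i≡j → 1+n≢n (trans (≡.sym j≡1+i) (≡.sym i≡j))
... | inj₂ (refl , refl)  = λ k≡0 → contradiction (subst (1 ≤_) k≡0 1≤k) λ ()

module _ (G : Graph n) where

  rim⇒wheel : ∀ h c cs → 1 ≤ length cs → Unique (h ∷ c ∷ cs) →
    All (AdjacentIfDistinct G h) (c ∷ cs) → Linked (AdjacentIfDistinct G) (c ∷ cs) →
    AdjacentIfDistinct G (last⁺ c cs) c → ContainsWheel G (length cs)
  rim⇒wheel h c cs 1≤k hub-rim@(h∉rim ∷ rim-unique) spokes rim closing =
    lookup (h ∷ c ∷ cs) , lookup-injective hub-rim , edge
    where
    k = length cs

    spoke : ∀ i → Adjacent G h (lookup (c ∷ cs) i)
    spoke i = All.lookup spokes (∈-lookup i) (All.lookup h∉rim (∈-lookup i))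

    rim-link : ∀ i j → toℕ j ≡ suc (toℕ i) % suc k → AdjacentIfDistinct G (lookup (c ∷ cs) i) (lookup (c ∷ cs) j)
    rim-link i j j≡ with cyclic-successor (toℕ<n i) j≡
    ... | inj₁ j≡1+i       = lookup-Linked rim j≡1+i
    ... | inj₂ (i≡k , j≡0) =
      subst₂ (AdjacentIfDistinct G) (≡.sym (lookup-last⁺ c cs i i≡k))
             (cong (lookup (c ∷ cs)) (≡.sym (toℕ-injective {j = fzero} j≡0))) closing

    rim-edge : ∀ i j → toℕ j ≡ suc (toℕ i) % suc k → Adjacent G (lookup (c ∷ cs) i) (lookup (c ∷ cs) j)
    rim-edge i j j≡ = rim-link i j j≡ λ ci≡cj →
      cyclic-successor-≢ 1≤k (toℕ<n i) j≡ (cong toℕ (lookup-injective rim-unique ci≡cj))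

    edge : ∀ x y → wheelAdj k x y ≡ true → Adjacent G (lookup (h ∷ c ∷ cs) x) (lookup (h ∷ c ∷ cs) y)
    edge fzero    (fsuc j) _ = spoke j
    edge (fsuc i) fzero    _ = Adjacent-sym G (spoke i)
    edge (fsuc i) (fsuc j) e =
      [ (λ t → rim-edge i j (≡ᵇ⇒≡ _ _ t)) , (λ t → Adjacent-sym G (rim-edge j i (≡ᵇ⇒≡ _ _ t))) ]′
        (Equivalence.to T-∨ (Equivalence.from T-≡ e))

module _ (G : Graph n) {V K : Subset n} (V⊆K : V ⊆ K) (KV : CompleteTo G K V) where

  -- The rim y₀ z₁ y₁ … z_m y_m may use vertices of V among the zᵢ: every rim edge meets V.
  joined-clique-rim⇒wheel : ∀ {h y₀ ys zs} → h ∈ V → All (_∈ V) (y₀ ∷ ys) → All (_∈ K) zs →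
    length zs ≡ length ys → 1 ≤ length ys → Unique (h ∷ y₀ ∷ ys ++ zs) → ContainsWheel G (2 * length ys)
  joined-clique-rim⇒wheel {h} {y₀} {ys} {zs} h∈V (y₀∈V ∷ ys⊆V) zs⊆K ∣zs∣≡∣ys∣ 1≤∣ys∣ unique =
    subst (ContainsWheel G) length-rim
      (rim⇒wheel G h y₀ (interleave zs ys) 1≤length-rim hub-rim-unique spokes linked closing)
    where
    length-rim : length (interleave zs ys) ≡ 2 * length ys
    length-rim = length-interleave-≡ zs ys ∣zs∣≡∣ys∣ refl

    1≤length-rim : 1 ≤ length (interleave zs ys)
    1≤length-rim = subst (1 ≤_) (≡.sym length-rim) (≤-trans 1≤∣ys∣ (m≤m+n _ _))

    hub-rim-unique : Unique (h ∷ y₀ ∷ interleave zs ys)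
    hub-rim-unique =
      Unique-resp-↭ (↭-prep h (↭-prep y₀ (↭-trans (++-comm ys zs) (↭-sym (interleave-↭ zs ys))))) unique

    spokes : All (AdjacentIfDistinct G h) (y₀ ∷ interleave zs ys)
    spokes = All.map (λ {x} x∈K → CompleteTo-sym G KV h x h∈V x∈K)
                     (V⊆K y₀∈V ∷ All-interleave zs⊆K (All.map V⊆K ys⊆V))

    linked : Linked (AdjacentIfDistinct G) (y₀ ∷ interleave zs ys)
    linked = Linked-interleave (λ {x} {y} x∈V y∈K → AdjacentIfDistinct-sym G (KV y x y∈K x∈V))
                               (λ {y} {x} y∈K x∈V → KV y x y∈K x∈V) y₀∈V ys⊆V zs⊆K ∣zs∣≡∣ys∣

    closing : AdjacentIfDistinct G (last⁺ y₀ (interleave zs ys)) y₀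
    closing = KV _ y₀ (V⊆K (last⁺-interleave {ys = zs} y₀∈V ys⊆V ∣zs∣≡∣ys∣)) y₀∈V

  joined-clique-pool⇒wheel : ∀ {m} → 1 ≤ m → ∀ vs cs → Unique (vs ++ cs) → All (_∈ V) vs → All (_∈ K) cs →
    2 + m ≤ length vs → 1 + 2 * m < length vs + length cs → ContainsWheel G (2 * m)
  joined-clique-pool⇒wheel {m} 1≤m (h ∷ y₀ ∷ vs) cs unique (h∈V ∷ y₀∈V ∷ vs⊆V) cs⊆K
                           (s≤s (s≤s m≤∣vs∣)) (s≤s (s≤s 2m≤∣vs++cs∣)) =
    subst (λ l → ContainsWheel G (2 * l)) ∣ys∣≡m
      (joined-clique-rim⇒wheel h∈V (y₀∈V ∷ All.take⁺ m vs⊆V)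
        (All.take⁺ m (All.++⁺ (All.drop⁺ m (All.map V⊆K vs⊆V)) cs⊆K))
        (trans (length-take-≤ m m≤∣rest∣) (≡.sym ∣ys∣≡m)) (subst (1 ≤_) (≡.sym ∣ys∣≡m) 1≤m) selected-unique)
    where
    ys   = take m vs
    rest = drop m vs ++ cs

    vs++cs≡ys++rest : vs ++ cs ≡ ys ++ rest
    vs++cs≡ys++rest = trans (cong (_++ cs) (≡.sym (take++drop≡id m vs))) (++-assoc ys (drop m vs) cs)

    ∣ys∣≡m : length ys ≡ m
    ∣ys∣≡m = length-take-≤ m m≤∣vs∣

    m≤∣rest∣ : m ≤ length rest
    m≤∣rest∣ = +-cancelˡ-≤ m m (length rest) $ begin
      m + m                   ≡⟨ cong (m +_) (+-identityʳ m) ⟨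
      2 * m                   ≤⟨ 2m≤∣vs++cs∣ ⟩
      length vs + length cs   ≡⟨ length-++ vs ⟨
      length (vs ++ cs)       ≡⟨ cong length vs++cs≡ys++rest ⟩
      length (ys ++ rest)     ≡⟨ length-++ ys ⟩
      length ys + length rest ≡⟨ cong (_+ length rest) ∣ys∣≡m ⟩
      m + length rest         ∎
      where open ≤-Reasoning

    selected-unique : Unique (h ∷ y₀ ∷ ys ++ take m rest)
    selected-unique = subst Unique (≡.sym (++-take (h ∷ y₀ ∷ ys) m))
      (Unique.take⁺ _ (subst (λ l → Unique (h ∷ y₀ ∷ l)) vs++cs≡ys++rest unique))

  joined-clique⇒wheel : ∀ {m} → 1 ≤ m → 2 + m ≤ ∣ V ∣ → 1 + 2 * m < ∣ K ∣ → ContainsWheel G (2 * m)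
  joined-clique⇒wheel {m} 1≤m 2+m≤∣V∣ 1+2m<∣K∣ =
    joined-clique-pool⇒wheel 1≤m (elements V) (elements C)
      (Unique-++-separated (λ x∈V x∈C → x∈p─q⇒x∉q x∈C x∈V)
        (elements-⊆ V) (elements-⊆ C) (elements-unique V) (elements-unique C))
      (elements-⊆ V) (All.map (p─q⊆p K V) (elements-⊆ C))
      (subst (2 + m ≤_) (≡.sym (length-elements V)) 2+m≤∣V∣)
      (≤-trans 1+2m<∣K∣ (≤-trans (∣p∣≤∣p─q∣+∣q∣ K V)
        (≤-reflexive (trans (+-comm ∣ C ∣ ∣ V ∣) (≡.sym (cong₂ _+_ (length-elements V) (length-elements C)))))))
    where
    C = K ─ V

module _ (H : Graph n) {V₁ V₂ V₃ : Subset n}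
         (c₁₂ : CompleteTo H V₁ V₂) (c₁₃ : CompleteTo H V₁ V₃) (c₂₃ : CompleteTo H V₂ V₃) where

  tripartite-rim⇒wheel : ∀ {w h p q as ds} → h ∈ V₂ → All (_∈ V₁) (p ∷ as) → All (_∈ V₃) (q ∷ ds) →
    length as ≡ length ds → Adjacent H w p → Adjacent H w h → Adjacent H w q →
    Unique (w ∷ h ∷ (p ∷ as) ++ (q ∷ ds)) → ContainsWheel H (2 * suc (length as))
  tripartite-rim⇒wheel {w} {h} {p} {q} {as} {ds} h∈V₂ (p∈V₁ ∷ as⊆V₁) (q∈V₃ ∷ ds⊆V₃) ∣as∣≡∣ds∣ wp wh wq unique =
    subst (ContainsWheel H) length-rim
      (rim⇒wheel H h p (w ∷ q ∷ interleave as ds) (s≤s z≤n) (Unique-resp-↭ reorder unique) spokes linked closing)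
    where
    length-rim : length (w ∷ q ∷ interleave as ds) ≡ 2 * suc (length as)
    length-rim = trans (cong (2 +_) (length-interleave-≡ as ds refl (≡.sym ∣as∣≡∣ds∣))) (≡.sym (*-suc 2 (length as)))

    reorder : w ∷ h ∷ (p ∷ as) ++ (q ∷ ds) ↭ h ∷ p ∷ w ∷ q ∷ interleave as ds
    reorder = ↭-sym (↭-trans (shift w (h ∷ p ∷ []) (q ∷ interleave as ds))
                (↭-prep w (↭-prep h (↭-prep p (↭-trans (↭-prep q (interleave-↭ as ds)) (↭-sym (shift q as ds)))))))

    spokes : All (AdjacentIfDistinct H h) (p ∷ w ∷ q ∷ interleave as ds)
    spokes = CompleteTo-sym H c₁₂ h p h∈V₂ p∈V₁ ∷ (λ _ → Adjacent-sym H wh) ∷ c₂₃ h q h∈V₂ q∈V₃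
           ∷ All-interleave (All.map (λ {x} → CompleteTo-sym H c₁₂ h x h∈V₂) as⊆V₁) (All.map (c₂₃ h _ h∈V₂) ds⊆V₃)

    linked : Linked (AdjacentIfDistinct H) (p ∷ w ∷ q ∷ interleave as ds)
    linked = (λ _ → Adjacent-sym H wp) ∷ (λ _ → wq)
           ∷ Linked-interleave (λ {x} {y} → CompleteTo-sym H c₁₃ x y) (λ {y} {x} → c₁₃ y x) q∈V₃ ds⊆V₃ as⊆V₁ ∣as∣≡∣ds∣

    closing : AdjacentIfDistinct H (last⁺ p (w ∷ q ∷ interleave as ds)) p
    closing = CompleteTo-sym H c₁₃ _ p (last⁺-interleave {ys = as} q∈V₃ ds⊆V₃ ∣as∣≡∣ds∣) p∈V₁

  complete-tripartite⇒wheel : ∀ {m} → 1 ≤ m →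
    (∀ x → ¬ (x ∈ V₁ × x ∈ V₂)) → (∀ x → ¬ (x ∈ V₁ × x ∈ V₃)) → (∀ x → ¬ (x ∈ V₂ × x ∈ V₃)) →
    m ≤ ∣ V₁ ∣ → m ≤ ∣ V₃ ∣ → ∀ {w y₁ y₂ y₃} → y₁ ∈ V₁ → y₂ ∈ V₂ → y₃ ∈ V₃ → w ∉ V₁ → w ∉ V₃ →
    Adjacent H w y₁ → Adjacent H w y₂ → Adjacent H w y₃ → ContainsWheel H (2 * m)
  complete-tripartite⇒wheel {suc k} _ d₁₂ d₁₃ d₂₃ 1+k≤∣V₁∣ 1+k≤∣V₃∣ {w} {p} {h} {q} p∈V₁ h∈V₂ q∈V₃ w∉V₁ w∉V₃ wp wh wq
    with distinct-elements (V₁ - p) k (s≤s⁻¹ (≤-trans 1+k≤∣V₁∣ (∣p∣≤1+∣p-x∣ V₁ p)))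
       | distinct-elements (V₃ - q) k (s≤s⁻¹ (≤-trans 1+k≤∣V₃∣ (∣p∣≤1+∣p-x∣ V₃ q)))
  ... | as , ∣as∣≡k , as⊆V₁-p , as-unique | ds , ∣ds∣≡k , ds⊆V₃-q , ds-unique =
    subst (λ l → ContainsWheel H (2 * suc l)) ∣as∣≡k
      (tripartite-rim⇒wheel h∈V₂ (p∈V₁ ∷ as⊆V₁) (q∈V₃ ∷ ds⊆V₃) (trans ∣as∣≡k (≡.sym ∣ds∣≡k)) wp wh wq
        (w∉ ∷ h∉ ∷ Unique-++-separated (λ x∈V₁ x∈V₃ → d₁₃ _ (x∈V₁ , x∈V₃)) (p∈V₁ ∷ as⊆V₁) (q∈V₃ ∷ ds⊆V₃)
                     (All-≢ (x∉p-x V₁ p) as⊆V₁-p ∷ as-unique) (All-≢ (x∉p-x V₃ q) ds⊆V₃-q ∷ ds-unique)))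
    where
    as⊆V₁ : All (_∈ V₁) as
    as⊆V₁ = All.map (p─q⊆p V₁ ⁅ p ⁆) as⊆V₁-p

    ds⊆V₃ : All (_∈ V₃) ds
    ds⊆V₃ = All.map (p─q⊆p V₃ ⁅ q ⁆) ds⊆V₃-q

    w∉ : All (w ≢_) (h ∷ (p ∷ as) ++ (q ∷ ds))
    w∉ = Adjacent⇒≢ H wh ∷ All.++⁺ (All-≢ w∉V₁ (p∈V₁ ∷ as⊆V₁)) (All-≢ w∉V₃ (q∈V₃ ∷ ds⊆V₃))

    h∉ : All (h ≢_) ((p ∷ as) ++ (q ∷ ds))
    h∉ = All.++⁺ (All-≢ (λ h∈V₁ → d₁₂ h (h∈V₁ , h∈V₂)) (p∈V₁ ∷ as⊆V₁))
                 (All-≢ (λ h∈V₃ → d₂₃ h (h∈V₂ , h∈V₃)) (q∈V₃ ∷ ds⊆V₃))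

HasNonNeighbourIn : Graph n → Subset n → Fin n → Set
HasNonNeighbourIn G V x = ∃ λ y → y ∈ V × x ≢ y × adj G x y ≡ false

module _ (G : Graph n) (V : Subset n) where

  hasNonNeighbourIn? : Decidable (HasNonNeighbourIn G V)
  hasNonNeighbourIn? x = any? λ y → y ∈? V ×-dec ¬? (x ≟ᶠ y) ×-dec adj G x y ≟ᵇ false

  joinedTo : Subset n
  joinedTo = ∁ (satisfying hasNonNeighbourIn?)

  joinedTo-complete : CompleteTo G joinedTo V
  joinedTo-complete x y x∈J y∈V x≢y = ¬-not λ xy≡false →
    x∈∁p⇒x∉p x∈J (∈-satisfying⁺ hasNonNeighbourIn? (y , y∈V , x≢y , xy≡false))

  ∉joinedTo⇒HasNonNeighbourIn : ∀ {x} → x ∉ joinedTo → HasNonNeighbourIn G V x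
  ∉joinedTo⇒HasNonNeighbourIn x∉J = ∈-satisfying⁻ hasNonNeighbourIn? (x∉∁p⇒x∈p x∉J)

  HasNonNeighbourIn-clique⇒∉ : CompleteTo G V V → ∀ {x} → HasNonNeighbourIn G V x → x ∉ V
  HasNonNeighbourIn-clique⇒∉ VV (y , y∈V , x≢y , xy≡false) x∈V =
    contradiction (trans (≡.sym (VV _ y x∈V y∈V x≢y)) xy≡false) λ ()

  clique⊆joinedTo : CompleteTo G V V → V ⊆ joinedTo
  clique⊆joinedTo VV x∈V = x∉p⇒x∈∁p λ x∈S →
    HasNonNeighbourIn-clique⇒∉ VV (∈-satisfying⁻ hasNonNeighbourIn? x∈S) x∈V

  clique⇒wheel⊎few-joined : ∀ {m} → 1 ≤ m → CompleteTo G V V → 2 + m ≤ ∣ V ∣ →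
    ContainsWheel G (2 * m) ⊎ ∣ joinedTo ∣ ≤ 1 + 2 * m
  clique⇒wheel⊎few-joined {m} 1≤m VV 2+m≤∣V∣ with ∣ joinedTo ∣ ≤? 1 + 2 * m
  ... | yes few  = inj₂ few
  ... | no  many = inj₁ (joined-clique⇒wheel G (clique⊆joinedTo VV) joinedTo-complete 1≤m 2+m≤∣V∣ (≰⇒> many))

common-non-neighbour : ∀ {n} (G : Graph n) {b} (V₁ V₂ V₃ : Subset n) → 3 * b < n →
  ∣ joinedTo G V₁ ∣ ≤ b → ∣ joinedTo G V₂ ∣ ≤ b → ∣ joinedTo G V₃ ∣ ≤ b →
  ∃ λ x → HasNonNeighbourIn G V₁ x × HasNonNeighbourIn G V₂ x × HasNonNeighbourIn G V₃ x
common-non-neighbour {n} G {b} V₁ V₂ V₃ 3b<n few₁ few₂ few₃ =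
  let x , x∉J = ∣p∣<n⇒∃∉ (J₁ ∪ J₂ ∪ J₃) ∣J∣<n in
  x , ∉joinedTo⇒HasNonNeighbourIn G V₁ (x∉J ∘ x∈p∪q⁺ ∘ inj₁)
    , ∉joinedTo⇒HasNonNeighbourIn G V₂ (x∉J ∘ x∈p∪q⁺ ∘ inj₂ ∘ x∈p∪q⁺ ∘ inj₁)
    , ∉joinedTo⇒HasNonNeighbourIn G V₃ (x∉J ∘ x∈p∪q⁺ ∘ inj₂ ∘ x∈p∪q⁺ ∘ inj₂)
  where
  J₁ = joinedTo G V₁
  J₂ = joinedTo G V₂
  J₃ = joinedTo G V₃

  ∣J∣<n : ∣ J₁ ∪ J₂ ∪ J₃ ∣ < n
  ∣J∣<n = begin-strict
    ∣ J₁ ∪ J₂ ∪ J₃ ∣           ≤⟨ ∣p∪q∣≤∣p∣+∣q∣ J₁ (J₂ ∪ J₃) ⟩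
    ∣ J₁ ∣ + ∣ J₂ ∪ J₃ ∣       ≤⟨ +-monoʳ-≤ ∣ J₁ ∣ (∣p∪q∣≤∣p∣+∣q∣ J₂ J₃) ⟩
    ∣ J₁ ∣ + (∣ J₂ ∣ + ∣ J₃ ∣) ≤⟨ +-mono-≤ few₁ (+-mono-≤ few₂ (≤-trans few₃ (m≤m+n b 0))) ⟩
    3 * b                      <⟨ 3b<n ⟩
    n                          ∎
    where open ≤-Reasoning

three-cliques⇒wheel : ∀ (G : Graph n) {m} → 1 ≤ m → 3 * (1 + 2 * m) < n → (V₁ V₂ V₃ : Subset n) →
  (∀ x → ¬ (x ∈ V₁ × x ∈ V₂)) → (∀ x → ¬ (x ∈ V₁ × x ∈ V₃)) → (∀ x → ¬ (x ∈ V₂ × x ∈ V₃)) →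
  CompleteTo G V₁ V₁ → CompleteTo G V₂ V₂ → CompleteTo G V₃ V₃ →
  2 + m ≤ ∣ V₁ ∣ → 2 + m ≤ ∣ V₂ ∣ → 2 + m ≤ ∣ V₃ ∣ →
  Anticomplete G V₁ V₂ → Anticomplete G V₁ V₃ → Anticomplete G V₂ V₃ →
  ContainsWheel G (2 * m) ⊎ ContainsWheel (complement G) (2 * m)
three-cliques⇒wheel G {m} 1≤m 3[1+2m]<n V₁ V₂ V₃ d₁₂ d₁₃ d₂₃ c₁ c₂ c₃ s₁ s₂ s₃ a₁₂ a₁₃ a₂₃
  with clique⇒wheel⊎few-joined G V₁ 1≤m c₁ s₁
     | clique⇒wheel⊎few-joined G V₂ 1≤m c₂ s₂
     | clique⇒wheel⊎few-joined G V₃ 1≤m c₃ s₃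
... | inj₁ wheel | _           | _           = inj₁ wheel
... | inj₂ _     | inj₁ wheel  | _           = inj₁ wheel
... | inj₂ _     | inj₂ _      | inj₁ wheel  = inj₁ wheel
... | inj₂ few₁  | inj₂ few₂   | inj₂ few₃
  with common-non-neighbour G V₁ V₂ V₃ 3[1+2m]<n few₁ few₂ few₃
... | x , nn₁@(y₁ , y₁∈V₁ , x≢y₁ , xy₁) , (y₂ , y₂∈V₂ , x≢y₂ , xy₂) , nn₃@(y₃ , y₃∈V₃ , x≢y₃ , xy₃) =
  inj₂ (complete-tripartite⇒wheel (complement G)
         (Anticomplete⇒CompleteTo-complement G a₁₂) (Anticomplete⇒CompleteTo-complement G a₁₃)
         (Anticomplete⇒CompleteTo-complement G a₂₃) 1≤m d₁₂ d₁₃ d₂₃ (≤-trans (m≤n+m m 2) s₁) (≤-trans (m≤n+m m 2) s₃)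
         y₁∈V₁ y₂∈V₂ y₃∈V₃ (HasNonNeighbourIn-clique⇒∉ G V₁ c₁ nn₁) (HasNonNeighbourIn-clique⇒∉ G V₃ c₃ nn₃)
         (nonadjacent⇒AdjacentIfDistinct-complement G xy₁ x≢y₁)
         (nonadjacent⇒AdjacentIfDistinct-complement G xy₂ x≢y₂)
         (nonadjacent⇒AdjacentIfDistinct-complement G xy₃ x≢y₃))

m+k≡n⇒m≤n : ∀ {m n} k → m + k ≡ n → m ≤ n
m+k≡n⇒m≤n {m} k refl = m≤m+n m k

order-bound : ∀ m → 3 * (1 + 2 * m) < (32 * m + 2010) / 3
order-bound m = begin-strict
  3 * (1 + 2 * m)               <⟨ n<1+n _ ⟩
  suc (3 * (1 + 2 * m))         ≡⟨ m*n/n≡m _ 3 ⟨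
  suc (3 * (1 + 2 * m)) * 3 / 3 ≤⟨ /-monoˡ-≤ 3 (m+k≡n⇒m≤n {suc (3 * (1 + 2 * m)) * 3} (14 * m + 1998) (eq m)) ⟩
  (32 * m + 2010) / 3           ∎
  where
  open ≤-Reasoning
  eq : ∀ m → suc (3 * (1 + 2 * m)) * 3 + (14 * m + 1998) ≡ 32 * m + 2010
  eq = solve-∀

clique-bound : ∀ {m v} → 4 * m + 998 ≤ 3 * v → 2 + m ≤ v
clique-bound {m} 4m+998≤3v = *-cancelˡ-≤ 3 (≤-trans (m+k≡n⇒m≤n (m + 992) (eq m)) 4m+998≤3v)
  where
  eq : ∀ m → 3 * (2 + m) + (m + 992) ≡ 4 * m + 998
  eq = solve-∀

proposition2 : (m : ℕ) → 3 ≤ m →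
    (G : Graph ((32 * m + 2010) / 3)) →
    (v₁ : Fin ((32 * m + 2010) / 3)) →
    16 * m + 1004 ≤ 3 * deg G v₁ →
    (V₁ V₂ V₃ : Subset ((32 * m + 2010) / 3)) →
    (∀ x → ¬ (x ∈ V₁ × x ∈ V₂)) →
    (∀ x → ¬ (x ∈ V₁ × x ∈ V₃)) →
    (∀ x → ¬ (x ∈ V₂ × x ∈ V₃)) →
    (∀ x y → x ∈ V₁ → y ∈ V₁ → x ≢ y → adj G x y ≡ true) →
    (∀ x y → x ∈ V₂ → y ∈ V₂ → x ≢ y → adj G x y ≡ true) →
    (∀ x y → x ∈ V₃ → y ∈ V₃ → x ≢ y → adj G x y ≡ true) →
    4 * m + 998 ≤ 3 * ∣ V₁ ∣ →
    4 * m + 998 ≤ 3 * ∣ V₂ ∣ →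
    4 * m + 998 ≤ 3 * ∣ V₃ ∣ →
    (∀ x y → x ∈ V₁ → y ∈ V₂ → adj G x y ≡ false) →
    (∀ x y → x ∈ V₁ → y ∈ V₃ → adj G x y ≡ false) →
    (∀ x y → x ∈ V₂ → y ∈ V₃ → adj G x y ≡ false) →
    (Σ (Fin ((32 * m + 2010) / 3)) λ a → Σ (Fin ((32 * m + 2010) / 3)) λ b →
      a ≢ b × a ∈ N G v₁ × b ∈ N G v₁ ×
      (∀ x → ((x ∈ V₁ ⊎ x ∈ V₂ ⊎ x ∈ V₃) → (x ∈ N G v₁ × x ≢ a × x ≢ b))
           × ((x ∈ N G v₁ × x ≢ a × x ≢ b) → (x ∈ V₁ ⊎ x ∈ V₂ ⊎ x ∈ V₃)))) →
    (Σ (Fin ((32 * m + 2010) / 3)) λ v₂ →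
      (v₂ ∈ V₁ ⊎ v₂ ∈ V₂ ⊎ v₂ ∈ V₃) × 16 * m + 1004 ≤ 3 * deg G v₂) →
    ContainsWheel G (2 * m) ⊎ ContainsWheel (complement G) (2 * m)
proposition2 m 3≤m G _ _ V₁ V₂ V₃ d₁₂ d₁₃ d₂₃ c₁ c₂ c₃ s₁ s₂ s₃ a₁₂ a₁₃ a₂₃ _ _ =
  three-cliques⇒wheel G (≤-trans (s≤s z≤n) 3≤m) (order-bound m) V₁ V₂ V₃ d₁₂ d₁₃ d₂₃ c₁ c₂ c₃
    (clique-bound s₁) (clique-bound s₂) (clique-bound s₃) a₁₂ a₁₃ a₂₃
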